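{- For all integers $s \ge 1$ and $t \ge 2$: (i) $|NE_{s,1}(213,132)| = 1$; (ii) $|NE_{s,t}(213,132)| = 2^{s-1}$.
   Context: For positive integers $s,t$, write each $x \in [st]=\{1,\dots,st\}$ uniquely as $x=(j-1)t+r$ with $1\le j\le s$ and $1\le r\le t$. The poset $NE_{s,t}$ is $[st]$ with the partial order $(j-1)t+r \preceq (j'-1)t+r'$ if and only if $j'\le j$ and $r'\le r$. A linear extension of a poset $([n],\preceq)$ is a permutation $\pi=\pi(1)\cdots\pi(n)$ of $[n]$ (one-line notation) such that whenever $a\preceq b$ and $a\ne b$, $a$ appears before $b$ in $\pi$. A permutation $\pi$ contains $\sigma$ if $\pi$ has a subsequence with the same relative order as $\sigma$, and avoids $\sigma$ otherwise. $P(\sigma_1,\dots,\sigma_k)$ denotes the set of linear extensions of the poset $P$ avoiding each of $\sigma_1,\dots,\sigma_k$. -}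

module Defs where

open import Data.Nat using (ℕ; zero; suc; _+_; _*_; _∸_; _≤_; _<_)
open import Data.List using (List; []; _∷_; _++_; map; length; lookup)
open import Data.List.Base using (upTo)
open import Data.List.Membership.Propositional using (_∈_)
open import Data.List.Relation.Binary.Permutation.Propositional using (_↭_)
open import Data.List.Relation.Binary.Sublist.Propositional using (_⊆_)
open import Data.List.Relation.Unary.Unique.Propositional using (Unique)
open import Data.Fin using (Fin; cast)
open import Data.Product using (Σ; ∃; _×_; _,_)
open import Relation.Binary.PropositionalEquality using (_≡_; _≢_)
open import Relation.Nullary using (¬_)
open import Function.Bundles using (_⇔_)

[_] : ℕ → List ℕ
[ n ] = map suc (upTo n)

NE≼ : ℕ → ℕ → ℕ → ℕ → Set
NE≼ s t a b =
  Σ ℕ λ j → Σ ℕ λ r → Σ ℕ λ j' → Σ ℕ λ r' →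
    (1 ≤ j) × (j ≤ s) × (1 ≤ r) × (r ≤ t) ×
    (1 ≤ j') × (j' ≤ s) × (1 ≤ r') × (r' ≤ t) ×
    (a ≡ (j ∸ 1) * t + r) × (b ≡ (j' ∸ 1) * t + r') ×
    (j' ≤ j) × (r' ≤ r)

Before : ℕ → ℕ → List ℕ → Set
Before a b π = Σ (List ℕ) λ xs → Σ (List ℕ) λ ys → (π ≡ xs ++ a ∷ ys) × (b ∈ ys)

IsLinExtNE : ℕ → ℕ → List ℕ → Set
IsLinExtNE s t π = (π ↭ [ s * t ]) ×
  (∀ a b → NE≼ s t a b → a ≢ b → Before a b π)

SameOrder : List ℕ → List ℕ → Set
SameOrder σ τ = Σ (length σ ≡ length τ) λ eq →
  ∀ (i j : Fin (length σ)) →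
    (lookup σ i < lookup σ j) ⇔ (lookup τ (cast eq i) < lookup τ (cast eq j))

Contains : List ℕ → List ℕ → Set
Contains π σ = Σ (List ℕ) λ τ → (τ ⊆ π) × SameOrder σ τ

Avoids : List ℕ → List ℕ → Set
Avoids π σ = ¬ Contains π σ

NE-213-132 : ℕ → ℕ → List ℕ → Set
NE-213-132 s t π = IsLinExtNE s t π ×
  Avoids π (2 ∷ 1 ∷ 3 ∷ []) × Avoids π (1 ∷ 3 ∷ 2 ∷ [])

HasCard : (List ℕ → Set) → ℕ → Set
HasCard P k = Σ (List (List ℕ)) λ xs →
  Unique xs × (∀ π → (π ∈ xs) ⇔ P π) × (length xs ≡ k)

-- Call x a cut of a poset on [n] when x + 1 and x are incomparable; in NE_{s,t} the cuts are the
-- multiples of t when t ≥ 2, and there are none when t = 1 (a chain). A permutation avoiding 213 and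
-- 132 is reverse layered: a decreasing sequence of increasing runs of consecutive values. In a linear
-- extension every x + 1 with x not a cut precedes x, so the runs have length at most 2 and a run
-- (x, x + 1) needs x to be a cut; conversely such a permutation lists every other pair in decreasing
-- order, hence respects the poset. Splitting off the run containing the maximum gives
-- L(m + 2) = L(m + 1) + [m + 1 is a cut] · L(m): without cuts L = 1, and with cuts at the multiples
-- of t the count is constant along each row and doubles at each of the s − 1 row boundaries.
module Submission where

open import Defs
open import Data.Empty using (⊥-elim)
open import Data.Fin using (Fin; zero; suc)
open import Data.List using (List; []; _∷_; _++_; map; length; upTo)
open import Data.List.Properties using (upTo-∷ʳ; map-++; ∷-injective; length-++; length-map)
open import Data.List.Membership.Propositional using (_∈_)
open import Data.List.Membership.Propositional.Properties
  using (∈-map⁺; ∈-map⁻; ∈-++⁺ˡ; ∈-++⁺ʳ; ∈-++⁻; ∈-upTo⁺; ∈-upTo⁻)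
open import Data.List.Relation.Unary.Any using (here; there)
open import Data.List.Relation.Unary.All using ([]; _∷_)
open import Data.List.Relation.Unary.All.Properties using (All¬⇒¬Any)
open import Data.List.Relation.Unary.AllPairs using ([]; _∷_)
open import Data.List.Relation.Unary.Unique.Propositional using (Unique)
import Data.List.Relation.Unary.Unique.Propositional.Properties as Unique
open import Data.List.Relation.Binary.Disjoint.Propositional using (Disjoint)
open import Data.List.Relation.Binary.Permutation.Propositional
  using (_↭_; ↭-refl; ↭-prep; ↭-swap; ↭-sym; ↭-trans; ↭⇒↭ₛ)
open import Data.List.Relation.Binary.Permutation.Propositional.Properties
  using (∈-resp-↭; ∷↭∷ʳ; drop-∷; ↭-length)
open import Data.List.Relation.Binary.Permutation.Setoid.Properties using (Unique-resp-↭)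
open import Data.List.Relation.Binary.Sublist.Propositional using (_⊆_; _∷_; _∷ʳ_; to∈; from∈)
open import Data.List.Relation.Binary.Sublist.Propositional.Properties using (∷ˡ⁻; ∷⁻)
open import Data.Nat using (ℕ; zero; suc; _+_; _*_; _∸_; _^_; _≤_; _<_; z≤n; s≤s; _≟_; NonZero; >-nonZero)
open import Data.Nat.Properties
open import Data.Nat.Divisibility
  using (_∣_; _∣?_; ∣1⇒≡1; ∣m+n∣m⇒∣n; n∣m*n; ∣⇒≤; ∣m∣n⇒∣m+n; ∣-reflexive; m%n≡0⇒n∣m)
open import Data.Nat.DivMod using (_%_; _/_; m%n<n; m≡m%n+[m/n]*n; m<n*o⇒m/o<n)
open import Data.Product using (∃; _×_; _,_; proj₁; proj₂)
open import Data.Sum using (inj₁; inj₂)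
open import Function using (_∘_)
open import Function.Bundles using (_⇔_; mk⇔; Equivalence)
open import Relation.Binary.Definitions using (tri<; tri≈; tri>)
open import Relation.Binary.PropositionalEquality
  using (_≡_; _≢_; refl; sym; trans; cong; cong₂; subst; setoid; module ≡-Reasoning)
open import Relation.Nullary using (¬_; Dec; yes; no)
open import Relation.Nullary.Decidable using (from-no)
open import Relation.Unary using (Decidable)
open import Relation.Unary.Properties using (∅?)

∈-[m]⁻ : ∀ {m x} → x ∈ [ m ] → 1 ≤ x × x ≤ m
∈-[m]⁻ x∈ with ∈-map⁻ suc x∈
... | _ , y∈ , refl = s≤s z≤n , ∈-upTo⁻ y∈

∈-[m]⁺ : ∀ {m x} → 1 ≤ x → x ≤ m → x ∈ [ m ]
∈-[m]⁺ {x = suc y} _ x≤m = ∈-map⁺ suc (∈-upTo⁺ x≤m)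

Unique-[m] : ∀ m → Unique [ m ]
Unique-[m] m = Unique.map⁺ suc-injective (Unique.upTo⁺ m)

[1+m]↭ : ∀ m → [ suc m ] ↭ suc m ∷ [ m ]
[1+m]↭ m = subst (_↭ suc m ∷ [ m ]) [m]∷ʳ1+m≡[1+m] (↭-sym (∷↭∷ʳ (suc m) [ m ]))
  where
  [m]∷ʳ1+m≡[1+m] : [ m ] ++ suc m ∷ [] ≡ [ suc m ]
  [m]∷ʳ1+m≡[1+m] = trans (sym (map-++ suc (upTo m) (m ∷ []))) (cong (map suc) (upTo-∷ʳ m))

∈-↭[m]⁻ : ∀ {m π x} → π ↭ [ m ] → x ∈ π → 1 ≤ x × x ≤ m
∈-↭[m]⁻ π↭ = ∈-[m]⁻ ∘ ∈-resp-↭ π↭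

∈-↭[m]⁺ : ∀ {m π x} → π ↭ [ m ] → 1 ≤ x → x ≤ m → x ∈ π
∈-↭[m]⁺ π↭ 1≤x x≤m = ∈-resp-↭ (↭-sym π↭) (∈-[m]⁺ 1≤x x≤m)

↭[m]⇒Unique : ∀ {m π} → π ↭ [ m ] → Unique π
↭[m]⇒Unique {m} π↭ = Unique-resp-↭ (setoid ℕ) (↭⇒↭ₛ (↭-sym π↭)) (Unique-[m] m)

Before-head : ∀ {a b xs} → b ∈ xs → Before a b (a ∷ xs)
Before-head {xs = xs} b∈xs = [] , xs , refl , b∈xs

Before-∷ : ∀ {a b z xs} → Before a b xs → Before a b (z ∷ xs)
Before-∷ {z = z} (xs′ , ys , refl , b∈ys) = z ∷ xs′ , ys , refl , b∈ys

Before-∷⁻ : ∀ {a b z xs} → a ≢ z → Before a b (z ∷ xs) → Before a b xs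
Before-∷⁻ a≢z ([] , ys , refl , b∈ys) = ⊥-elim (a≢z refl)
Before-∷⁻ a≢z (_ ∷ xs′ , ys , refl , b∈ys) = xs′ , ys , refl , b∈ys

¬Before-head : ∀ {a b xs} → Unique (b ∷ xs) → ¬ Before a b (b ∷ xs)
¬Before-head (b∉xs ∷ _) before = All¬⇒¬Any b∉xs (b∈tail before)
  where
  b∈tail : ∀ {a b xs} → Before a b (b ∷ xs) → b ∈ xs
  b∈tail ([] , ys , refl , b∈ys) = b∈ys
  b∈tail (_ ∷ xs′ , ys , refl , b∈ys) = ∈-++⁺ʳ xs′ (there b∈ys)

Occurs₃ : (ℕ → ℕ → ℕ → Set) → List ℕ → Set
Occurs₃ P π = ∃ λ a → ∃ λ b → ∃ λ d → (a ∷ b ∷ d ∷ []) ⊆ π × P a b d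

Shape213 Shape132 : ℕ → ℕ → ℕ → Set
Shape213 a b d = b < a × a < d
Shape132 a b d = a < d × d < b

Occurs₃-∷ : ∀ {P z π} → Occurs₃ P π → Occurs₃ P (z ∷ π)
Occurs₃-∷ {z = z} (a , b , d , abd⊆π , shape) = a , b , d , z ∷ʳ abd⊆π , shape

private
  ⇔-both : {A B : Set} → A → B → A ⇔ B
  ⇔-both a b = mk⇔ (λ _ → b) (λ _ → a)

  ⇔-neither : {A B : Set} → ¬ A → ¬ B → A ⇔ B
  ⇔-neither ¬a ¬b = mk⇔ (⊥-elim ∘ ¬a) (⊥-elim ∘ ¬b)

contains-213⇔ : ∀ {π} → Contains π (2 ∷ 1 ∷ 3 ∷ []) ⇔ Occurs₃ Shape213 π
contains-213⇔ = mk⇔ to from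
  where
  to : ∀ {π} → Contains π (2 ∷ 1 ∷ 3 ∷ []) → Occurs₃ Shape213 π
  to (a ∷ b ∷ d ∷ [] , τ⊆π , _ , order) =
    a , b , d , τ⊆π , Equivalence.to (order (suc zero) zero) ≤-refl
                    , Equivalence.to (order zero (suc (suc zero))) ≤-refl
  from : ∀ {π} → Occurs₃ Shape213 π → Contains π (2 ∷ 1 ∷ 3 ∷ [])
  from (a , b , d , τ⊆π , b<a , a<d) = a ∷ b ∷ d ∷ [] , τ⊆π , refl , order
    where
    order : ∀ (i j : Fin 3) → _
    order zero             zero             = ⇔-neither (<-irrefl refl) (<-irrefl refl)
    order zero             (suc zero)       = ⇔-neither (from-no (2 <? 1)) (<-asym b<a)
    order zero             (suc (suc zero)) = ⇔-both ≤-refl a<d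
    order (suc zero)       zero             = ⇔-both ≤-refl b<a
    order (suc zero)       (suc zero)       = ⇔-neither (<-irrefl refl) (<-irrefl refl)
    order (suc zero)       (suc (suc zero)) = ⇔-both (s≤s (s≤s z≤n)) (<-trans b<a a<d)
    order (suc (suc zero)) zero             = ⇔-neither (from-no (3 <? 2)) (<-asym a<d)
    order (suc (suc zero)) (suc zero)       = ⇔-neither (from-no (3 <? 1)) (<-asym (<-trans b<a a<d))
    order (suc (suc zero)) (suc (suc zero)) = ⇔-neither (<-irrefl refl) (<-irrefl refl)

contains-132⇔ : ∀ {π} → Contains π (1 ∷ 3 ∷ 2 ∷ []) ⇔ Occurs₃ Shape132 π
contains-132⇔ = mk⇔ to from
  where
  to : ∀ {π} → Contains π (1 ∷ 3 ∷ 2 ∷ []) → Occurs₃ Shape132 π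
  to (a ∷ b ∷ d ∷ [] , τ⊆π , _ , order) =
    a , b , d , τ⊆π , Equivalence.to (order zero (suc (suc zero))) (s≤s (s≤s z≤n))
                    , Equivalence.to (order (suc (suc zero)) (suc zero)) ≤-refl
  from : ∀ {π} → Occurs₃ Shape132 π → Contains π (1 ∷ 3 ∷ 2 ∷ [])
  from (a , b , d , τ⊆π , a<d , d<b) = a ∷ b ∷ d ∷ [] , τ⊆π , refl , order
    where
    order : ∀ (i j : Fin 3) → _
    order zero             zero             = ⇔-neither (<-irrefl refl) (<-irrefl refl)
    order zero             (suc zero)       = ⇔-both (s≤s (s≤s z≤n)) (<-trans a<d d<b)
    order zero             (suc (suc zero)) = ⇔-both (s≤s (s≤s z≤n)) a<d
    order (suc zero)       zero             = ⇔-neither (from-no (3 <? 1)) (<-asym (<-trans a<d d<b))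
    order (suc zero)       (suc zero)       = ⇔-neither (<-irrefl refl) (<-irrefl refl)
    order (suc zero)       (suc (suc zero)) = ⇔-neither (from-no (3 <? 2)) (<-asym d<b)
    order (suc (suc zero)) zero             = ⇔-neither (from-no (2 <? 1)) (<-asym a<d)
    order (suc (suc zero)) (suc zero)       = ⇔-both ≤-refl d<b
    order (suc (suc zero)) (suc (suc zero)) = ⇔-neither (<-irrefl refl) (<-irrefl refl)

∈-∷∷⁻ : ∀ {x h y : ℕ} {π} → x ∈ h ∷ y ∷ π → x ≢ h → x ≢ y → x ∈ π
∈-∷∷⁻ (here x≡h) x≢h _ = ⊥-elim (x≢h x≡h)
∈-∷∷⁻ (there (here x≡y)) _ x≢y = ⊥-elim (x≢y x≡y)
∈-∷∷⁻ (there (there x∈π)) _ _ = x∈π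

[2+m]↭ : ∀ m → [ suc (suc m) ] ↭ suc m ∷ suc (suc m) ∷ [ m ]
[2+m]↭ m = ↭-trans ([1+m]↭ (suc m)) (↭-trans (↭-prep _ ([1+m]↭ m)) (↭-swap _ _ ↭-refl))

-- A next entry below h would form a 213 with n, one above h other than h + 1 a 132 with h + 1.
head<max⇒next≡suc : ∀ {n h π} → (h ∷ π) ↭ [ n ] → h < n →
  ¬ Occurs₃ Shape213 (h ∷ π) → ¬ Occurs₃ Shape132 (h ∷ π) → ∃ λ π′ → π ≡ suc h ∷ π′
head<max⇒next≡suc {n} {h} {[]} π↭ h<n _ _ with ∈-↭[m]⁺ π↭ (≤-trans (s≤s z≤n) h<n) ≤-refl
... | here n≡h = ⊥-elim (<-irrefl (sym n≡h) h<n)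
head<max⇒next≡suc {n} {h} {y ∷ π} π↭ h<n ¬213 ¬132 with <-cmp y h
... | tri< y<h _ _ =
  ⊥-elim (¬213 (h , y , n , refl ∷ refl ∷ from∈ (∈-∷∷⁻ n∈ (>⇒≢ h<n) (>⇒≢ (<-trans y<h h<n))) , y<h , h<n))
  where
  n∈ : n ∈ h ∷ y ∷ π
  n∈ = ∈-↭[m]⁺ π↭ (≤-trans (s≤s z≤n) h<n) ≤-refl
... | tri≈ _ refl _ with ↭[m]⇒Unique π↭
...   | (h≢h ∷ _) ∷ _ = ⊥-elim (h≢h refl)
head<max⇒next≡suc {n} {h} {y ∷ π} π↭ h<n ¬213 ¬132 | tri> _ _ h<y with y ≟ suc h
... | yes refl = π , refl
... | no y≢1+h =
  ⊥-elim (¬132 (h , y , suc h , refl ∷ refl ∷ from∈ (∈-∷∷⁻ 1+h∈ 1+n≢n (y≢1+h ∘ sym)) , ≤-refl , 1+h<y))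
  where
  1+h∈ : suc h ∈ h ∷ y ∷ π
  1+h∈ = ∈-↭[m]⁺ π↭ (s≤s z≤n) h<n
  1+h<y : suc h < y
  1+h<y = ≤∧≢⇒< h<y (y≢1+h ∘ sym)

LinExt : (ℕ → ℕ → Set) → ℕ → List ℕ → Set
LinExt _≼_ n π = (π ↭ [ n ]) × (∀ a b → a ≼ b → a ≢ b → Before a b π)

LinExt-213-132 : (ℕ → ℕ → Set) → ℕ → List ℕ → Set
LinExt-213-132 _≼_ n π = LinExt _≼_ n π × Avoids π (2 ∷ 1 ∷ 3 ∷ []) × Avoids π (1 ∷ 3 ∷ 2 ∷ [])

module ReverseLayered {Cut : ℕ → Set} (Cut? : Decidable Cut) where

  -- Reverse layered permutations of [m] with layers of size at most 2, where a layer {x, x + 1}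
  -- (written x, x + 1) is allowed only when x is a cut.
  data RevLayered : ℕ → List ℕ → Set where
    []     : RevLayered 0 []
    single : ∀ {m π} → RevLayered m π → RevLayered (suc m) (suc m ∷ π)
    pair   : ∀ {m π} → Cut (suc m) → RevLayered m π →
             RevLayered (suc (suc m)) (suc m ∷ suc (suc m) ∷ π)

  RevLayered⇒↭ : ∀ {m π} → RevLayered m π → π ↭ [ m ]
  RevLayered⇒↭ []             = ↭-refl
  RevLayered⇒↭ (single {m} r) = ↭-trans (↭-prep _ (RevLayered⇒↭ r)) (↭-sym ([1+m]↭ m))
  RevLayered⇒↭ (pair {m} _ r) = ↭-trans (↭-prep _ (↭-prep _ (RevLayered⇒↭ r))) (↭-sym ([2+m]↭ m))

  RevLayered-∈⁻ : ∀ {m π x} → RevLayered m π → x ∈ π → x ≤ m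
  RevLayered-∈⁻ r = proj₂ ∘ ∈-↭[m]⁻ (RevLayered⇒↭ r)

  RevLayered-∈⁺ : ∀ {m π x} → RevLayered m π → 1 ≤ x → x ≤ m → x ∈ π
  RevLayered-∈⁺ r = ∈-↭[m]⁺ (RevLayered⇒↭ r)

  -- Only its layer-mate exceeds an entry, and the layer-mate comes immediately after it.
  RevLayered⇒¬gapped-ascent : ∀ {m π a b d} → RevLayered m π → (a ∷ b ∷ d ∷ []) ⊆ π → ¬ a < d
  RevLayered⇒¬gapped-ascent (single r) (_ ∷ʳ σ) = RevLayered⇒¬gapped-ascent r σ
  RevLayered⇒¬gapped-ascent (single r) (refl ∷ σ) a<d =
    <⇒≱ a<d (m≤n⇒m≤1+n (RevLayered-∈⁻ r (to∈ (∷ˡ⁻ σ))))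
  RevLayered⇒¬gapped-ascent (pair _ r) (_ ∷ʳ _ ∷ʳ σ) = RevLayered⇒¬gapped-ascent r σ
  RevLayered⇒¬gapped-ascent (pair _ r) (_ ∷ʳ refl ∷ σ) a<d =
    <⇒≱ a<d (m≤n⇒m≤1+n (m≤n⇒m≤1+n (RevLayered-∈⁻ r (to∈ (∷ˡ⁻ σ)))))
  RevLayered⇒¬gapped-ascent (pair _ r) (refl ∷ σ) a<d =
    <⇒≱ a<d (m≤n⇒m≤1+n (RevLayered-∈⁻ r (to∈ (∷⁻ σ))))

  RevLayered⇒¬213 : ∀ {m π} → RevLayered m π → ¬ Occurs₃ Shape213 π
  RevLayered⇒¬213 r (_ , _ , _ , σ , _ , a<d) = RevLayered⇒¬gapped-ascent r σ a<d

  RevLayered⇒¬132 : ∀ {m π} → RevLayered m π → ¬ Occurs₃ Shape132 π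
  RevLayered⇒¬132 r (_ , _ , _ , σ , a<d , _) = RevLayered⇒¬gapped-ascent r σ a<d

  RevLayered⇒Before : ∀ {m π a b} → RevLayered m π → b < a → a ≤ m → 1 ≤ b →
    (a ≡ suc b → ¬ Cut b) → Before a b π
  RevLayered⇒Before [] () z≤n _ _
  RevLayered⇒Before (single r) b<a a≤1+m 1≤b cut-exempt with m≤n⇒m<n∨m≡n a≤1+m
  ... | inj₂ refl   = Before-head (RevLayered-∈⁺ r 1≤b (≤-pred b<a))
  ... | inj₁ a<1+m  = Before-∷ (RevLayered⇒Before r b<a (≤-pred a<1+m) 1≤b cut-exempt)
  RevLayered⇒Before (pair {m} cut r) b<a a≤2+m 1≤b cut-exempt with m≤n⇒m<n∨m≡n a≤2+m
  ... | inj₂ refl with m≤n⇒m<n∨m≡n (≤-pred b<a)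
  ...   | inj₂ refl  = ⊥-elim (cut-exempt refl cut)
  ...   | inj₁ b<1+m = Before-∷ (Before-head (RevLayered-∈⁺ r 1≤b (≤-pred b<1+m)))
  RevLayered⇒Before (pair {m} cut r) b<a a≤2+m 1≤b cut-exempt | inj₁ a<2+m with m≤n⇒m<n∨m≡n (≤-pred a<2+m)
  ... | inj₂ refl  = Before-head (there (RevLayered-∈⁺ r 1≤b (≤-pred b<a)))
  ... | inj₁ a<1+m = Before-∷ (Before-∷ (RevLayered⇒Before r b<a (≤-pred a<1+m) 1≤b cut-exempt))

  revLayered : ℕ → List (List ℕ)
  revLayered zero          = [] ∷ []
  revLayered (suc zero)    = (1 ∷ []) ∷ []
  revLayered (suc (suc m)) = map (suc (suc m) ∷_) (revLayered (suc m)) ++ pairs (Cut? (suc m))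
    where
    pairs : Dec (Cut (suc m)) → List (List ℕ)
    pairs (yes _) = map (λ π → suc m ∷ suc (suc m) ∷ π) (revLayered m)
    pairs (no _)  = []

  ∈-revLayered⇔ : ∀ {m π} → π ∈ revLayered m ⇔ RevLayered m π
  ∈-revLayered⇔ = mk⇔ to from
    where
    to : ∀ {m π} → π ∈ revLayered m → RevLayered m π
    to {zero}        (here refl) = []
    to {suc zero}    (here refl) = single []
    to {suc (suc m)} π∈ with ∈-++⁻ (map (suc (suc m) ∷_) (revLayered (suc m))) π∈
    ... | inj₁ π∈singles with ∈-map⁻ (suc (suc m) ∷_) π∈singles
    ...   | _ , π′∈ , refl = single (to π′∈)
    to {suc (suc m)} π∈ | inj₂ π∈pairs with Cut? (suc m)
    ... | yes cut with ∈-map⁻ (λ π → suc m ∷ suc (suc m) ∷ π) π∈pairs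
    ...   | _ , π′∈ , refl = pair cut (to π′∈)
    to {suc (suc m)} π∈ | inj₂ () | no _

    from : ∀ {m π} → RevLayered m π → π ∈ revLayered m
    from []                 = here refl
    from (single {zero} []) = here refl
    from (single {suc m} r) = ∈-++⁺ˡ (∈-map⁺ (suc (suc m) ∷_) (from r))
    from (pair {m} cut r) with Cut? (suc m)
    ... | yes _   = ∈-++⁺ʳ (map (suc (suc m) ∷_) (revLayered (suc m))) (∈-map⁺ _ (from r))
    ... | no ¬cut = ⊥-elim (¬cut cut)

  Unique-revLayered-step : ∀ {m} → Unique (revLayered (suc m)) → Unique (revLayered m) →
    Unique (revLayered (suc (suc m)))
  Unique-revLayered-step {m} _ _ with Cut? (suc m)
  Unique-revLayered-step {m} u₁ _ | no _ = Unique.++⁺ (Unique.map⁺ (proj₂ ∘ ∷-injective) u₁) [] λ ()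
  Unique-revLayered-step {m} u₁ u₀ | yes _ =
    Unique.++⁺ (Unique.map⁺ (proj₂ ∘ ∷-injective) u₁)
               (Unique.map⁺ (proj₂ ∘ ∷-injective ∘ proj₂ ∘ ∷-injective) u₀)
               heads-differ
    where
    heads-differ : Disjoint (map (suc (suc m) ∷_) (revLayered (suc m)))
                            (map (λ π → suc m ∷ suc (suc m) ∷ π) (revLayered m))
    heads-differ (π∈singles , π∈pairs) with ∈-map⁻ _ π∈singles | ∈-map⁻ _ π∈pairs
    ... | _ , _ , refl | _ , _ , eq = 1+n≢n (proj₁ (∷-injective eq))

  Unique-revLayered : ∀ m → Unique (revLayered m)
  Unique-revLayered zero          = [] ∷ []
  Unique-revLayered (suc zero)    = [] ∷ []
  Unique-revLayered (suc (suc m)) =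
    Unique-revLayered-step (Unique-revLayered (suc m)) (Unique-revLayered m)

  length-revLayered-cut : ∀ {m} → Cut (suc m) →
    length (revLayered (suc (suc m))) ≡ length (revLayered (suc m)) + length (revLayered m)
  length-revLayered-cut {m} cut with Cut? (suc m)
  ... | yes _   = trans (length-++ (map (suc (suc m) ∷_) (revLayered (suc m))))
                        (cong₂ _+_ (length-map _ (revLayered (suc m))) (length-map _ (revLayered m)))
  ... | no ¬cut = ⊥-elim (¬cut cut)

  length-revLayered-¬cut : ∀ {m} → ¬ Cut (suc m) →
    length (revLayered (suc (suc m))) ≡ length (revLayered (suc m))
  length-revLayered-¬cut {m} ¬cut with Cut? (suc m)
  ... | yes cut = ⊥-elim (¬cut cut)
  ... | no _    = trans (length-++ (map (suc (suc m) ∷_) (revLayered (suc m))))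
                        (trans (+-identityʳ _) (length-map _ (revLayered (suc m))))

  DescendsAtNonCuts : ℕ → List ℕ → Set
  DescendsAtNonCuts m π = ∀ x → 1 ≤ x → x < m → ¬ Cut x → Before (suc x) x π

  DescendsAtNonCuts-∷⁻ : ∀ {m n z π} → m ≤ n → m < z →
    DescendsAtNonCuts n (z ∷ π) → DescendsAtNonCuts m π
  DescendsAtNonCuts-∷⁻ m≤n m<z desc x 1≤x x<m ¬cut =
    Before-∷⁻ (λ 1+x≡z → <⇒≱ m<z (subst (_≤ _) 1+x≡z x<m)) (desc x 1≤x (≤-trans x<m m≤n) ¬cut)

  module _ (no-adjacent-cuts : ∀ {x} → Cut x → ¬ Cut (suc x)) where

    -- h + 1 must precede h unless h is a cut, and h + 2 must precede h + 1 unless h + 1 = n.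
    ascent-at-head⇒cut : ∀ {n h π} → (h ∷ suc h ∷ π) ↭ [ n ] → 1 ≤ h → h < n →
      DescendsAtNonCuts n (h ∷ suc h ∷ π) → suc h ≡ n × Cut h
    ascent-at-head⇒cut {h = h} π↭ 1≤h h<n desc with ↭[m]⇒Unique π↭ | Cut? h
    ... | unique | no ¬cut = ⊥-elim (¬Before-head unique (desc _ 1≤h h<n ¬cut))
    ... | _ ∷ unique | yes cut with m≤n⇒m<n∨m≡n h<n
    ...   | inj₂ 1+h≡n = 1+h≡n , cut
    ...   | inj₁ 1+h<n =
      ⊥-elim (¬Before-head unique (Before-∷⁻ (λ ()) (desc _ (s≤s z≤n) 1+h<n (no-adjacent-cuts cut))))

    RevLayered-complete : ∀ {m π} → π ↭ [ m ] → ¬ Occurs₃ Shape213 π → ¬ Occurs₃ Shape132 π →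
      DescendsAtNonCuts m π → RevLayered m π
    RevLayered-complete {zero} {[]} _ _ _ _ = []
    RevLayered-complete {zero} {_ ∷ _} π↭ = ⊥-elim (1+n≢0 (↭-length π↭))
    RevLayered-complete {suc m} {[]} π↭ = ⊥-elim (0≢1+n (↭-length π↭))
    RevLayered-complete {suc m} {h ∷ π} π↭ ¬213 ¬132 desc with h ≟ suc m
    ... | yes refl =
      single (RevLayered-complete (drop-∷ (↭-trans π↭ ([1+m]↭ m)))
                                  (¬213 ∘ Occurs₃-∷) (¬132 ∘ Occurs₃-∷)
                                  (DescendsAtNonCuts-∷⁻ (n≤1+n m) ≤-refl desc))
    ... | no h≢1+m with ∈-↭[m]⁻ π↭ (here refl)
    ...   | 1≤h@(s≤s z≤n) , h≤1+m with head<max⇒next≡suc π↭ (≤∧≢⇒< h≤1+m h≢1+m) ¬213 ¬132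
    ...     | π′ , refl with ascent-at-head⇒cut π↭ 1≤h (≤∧≢⇒< h≤1+m h≢1+m) desc
    ...       | refl , cut =
      pair cut (RevLayered-complete (drop-∷ (drop-∷ (↭-trans π↭ ([2+m]↭ _))))
                                    (¬213 ∘ Occurs₃-∷ ∘ Occurs₃-∷) (¬132 ∘ Occurs₃-∷ ∘ Occurs₃-∷)
                                    (DescendsAtNonCuts-∷⁻ ≤-refl (m≤n⇒m≤1+n (n<1+n _))
                                      (DescendsAtNonCuts-∷⁻ (m≤n+m _ 2) (n<1+n _) desc)))

    HasCard-LinExt-213-132 : ∀ (_≼_ : ℕ → ℕ → Set) n →
      (∀ {a b} → a ≼ b → a ≢ b → b < a × 1 ≤ b × a ≤ n) →
      (∀ {x} → 1 ≤ x → x < n → ¬ Cut x → suc x ≼ x) →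
      (∀ {x} → Cut x → ¬ suc x ≼ x) →
      HasCard (LinExt-213-132 _≼_ n) (length (revLayered n))
    HasCard-LinExt-213-132 _≼_ n ≼-bounds ≼-step ≼-cut =
      revLayered n , Unique-revLayered n ,
      (λ π → mk⇔ (sound ∘ Equivalence.to ∈-revLayered⇔) (Equivalence.from ∈-revLayered⇔ ∘ complete)) ,
      refl
      where
      sound : ∀ {π} → RevLayered n π → LinExt-213-132 _≼_ n π
      sound r = (RevLayered⇒↭ r , ordered) ,
                RevLayered⇒¬213 r ∘ Equivalence.to contains-213⇔ ,
                RevLayered⇒¬132 r ∘ Equivalence.to contains-132⇔
        where
        ordered : ∀ a b → a ≼ b → a ≢ b → Before a b _
        ordered a b a≼b a≢b with ≼-bounds a≼b a≢b
        ... | b<a , 1≤b , a≤n = RevLayered⇒Before r b<a a≤n 1≤b λ { refl cut → ≼-cut cut a≼b }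
      complete : ∀ {π} → LinExt-213-132 _≼_ n π → RevLayered n π
      complete ((π↭ , ordered) , avoids213 , avoids132) =
        RevLayered-complete π↭
          (avoids213 ∘ Equivalence.from contains-213⇔)
          (avoids132 ∘ Equivalence.from contains-132⇔)
          (λ x 1≤x x<n ¬cut → ordered (suc x) x (≼-step 1≤x x<n ¬cut) 1+n≢n)

∣⇒∤suc : ∀ {t n} → 1 < t → t ∣ n → ¬ t ∣ suc n
∣⇒∤suc {t} {n} 1<t t∣n t∣1+n =
  <-irrefl (sym (∣1⇒≡1 (∣m+n∣m⇒∣n (subst (t ∣_) (+-comm 1 n) t∣1+n) t∣n))) 1<t

∤-within-row : ∀ {t r} k → 0 < r → r < t → ¬ t ∣ r + k * t
∤-within-row {t} {r} k 0<r r<t t∣r+kt =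
  <⇒≱ r<t (∣⇒≤ {{>-nonZero 0<r}} (∣m+n∣m⇒∣n (subst (t ∣_) (+-comm r (k * t)) t∣r+kt) (n∣m*n k)))

NE-label≤ : ∀ {s t j r} → 1 ≤ j → j ≤ s → r ≤ t → (j ∸ 1) * t + r ≤ s * t
NE-label≤ {zero} (s≤s _) ()
NE-label≤ {suc s} {t} _ j≤1+s r≤t =
  ≤-trans (+-mono-≤ (*-monoˡ-≤ t (∸-monoˡ-≤ 1 j≤1+s)) r≤t) (≤-reflexive (+-comm (s * t) t))

NE≼-bounds : ∀ {s t a b} → NE≼ s t a b → a ≢ b → b < a × 1 ≤ b × a ≤ s * t
NE≼-bounds {t = t} (j , r , j′ , r′ , 1≤j , j≤s , _ , r≤t , _ , _ , 1≤r′ , _ , refl , refl , j′≤j , r′≤r) a≢b =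
  ≤∧≢⇒< (+-mono-≤ (*-monoˡ-≤ t (∸-monoˡ-≤ 1 j′≤j)) r′≤r) (a≢b ∘ sym) ,
  ≤-trans 1≤r′ (m≤n+m r′ _) ,
  NE-label≤ 1≤j j≤s r≤t

NE≼-chain-step : ∀ {s x} → 1 ≤ x → x < s → NE≼ s 1 (suc x) x
NE≼-chain-step {x = suc x} _ 1+x<s =
  suc (suc x) , 1 , suc x , 1 , s≤s z≤n , 1+x<s , ≤-refl , ≤-refl , s≤s z≤n , <⇒≤ 1+x<s , ≤-refl , ≤-refl ,
  1+n≡n*1+1 (suc x) , 1+n≡n*1+1 x , n≤1+n _ , ≤-refl
  where
  1+n≡n*1+1 : ∀ n → suc n ≡ n * 1 + 1
  1+n≡n*1+1 n = sym (trans (cong (_+ 1) (*-identityʳ n)) (+-comm n 1))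

NE≼-row-step : ∀ {s t x} .{{_ : NonZero t}} → ¬ t ∣ x → x < s * t → NE≼ s t (suc x) x
NE≼-row-step {s} {t} {x} t∤x x<st =
  suc q , suc ρ , suc q , ρ , s≤s z≤n , q<s , s≤s z≤n , m%n<n x t , s≤s z≤n , q<s , 1≤ρ , <⇒≤ (m%n<n x t) ,
  trans (cong suc x≡qt+ρ) (sym (+-suc (q * t) ρ)) , x≡qt+ρ , ≤-refl , n≤1+n ρ
  where
  ρ q : ℕ
  ρ = x % t
  q = x / t
  x≡qt+ρ : x ≡ q * t + ρ
  x≡qt+ρ = trans (m≡m%n+[m/n]*n x t) (+-comm ρ (q * t))
  1≤ρ : 1 ≤ ρ
  1≤ρ = n≢0⇒n>0 (t∤x ∘ m%n≡0⇒n∣m x t)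
  q<s : q < s
  q<s = m<n*o⇒m/o<n x<st

-- t ∣ b forces b to end its row (r′ = t), hence r = t and t ∣ suc b as well.
NE≼-∣⇒¬step : ∀ {s t b} → 1 < t → t ∣ b → ¬ NE≼ s t (suc b) b
NE≼-∣⇒¬step {t = t} 1<t t∣b (j , r , j′ , r′ , _ , _ , _ , r≤t , _ , _ , 1≤r′ , _ , 1+b≡ , refl , _ , r′≤r) =
  ∣⇒∤suc 1<t t∣b (subst (t ∣_) (sym 1+b≡) (∣m∣n⇒∣m+n (n∣m*n (j ∸ 1)) (∣-reflexive (sym r≡t))))
  where
  t≤r′ : t ≤ r′
  t≤r′ = ∣⇒≤ {{>-nonZero 1≤r′}} (∣m+n∣m⇒∣n t∣b (n∣m*n (j′ ∸ 1)))
  r≡t : r ≡ t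
  r≡t = ≤-antisym r≤t (≤-trans t≤r′ r′≤r)

module NoCuts = ReverseLayered ∅?

length-revLayered-no-cuts : ∀ m → length (NoCuts.revLayered m) ≡ 1
length-revLayered-no-cuts zero          = refl
length-revLayered-no-cuts (suc zero)    = refl
length-revLayered-no-cuts (suc (suc m)) =
  trans (NoCuts.length-revLayered-¬cut {m} (λ ())) (length-revLayered-no-cuts (suc m))

module DivisibilityCuts (t : ℕ) = ReverseLayered (t ∣?_)

module _ (u : ℕ) where
  private
    t : ℕ
    t = suc (suc u)
    open DivisibilityCuts t

    L : ℕ → ℕ
    L m = length (revLayered m)

  -- Positions are written suc r + k * t, not k * t + suc r, so that row boundaries unfold definitionally.
  length-revLayered-∣ : ∀ k r → r < t → L (suc r + k * t) ≡ 2 ^ k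
  length-revLayered-∣ zero    zero    _     = refl
  length-revLayered-∣ (suc k) zero    _     = begin
    L (suc (suc k * t))                        ≡⟨ length-revLayered-cut (n∣m*n (suc k)) ⟩
    L (suc (suc u) + k * t) + L (suc u + k * t) ≡⟨ cong₂ _+_ (length-revLayered-∣ k (suc u) ≤-refl)
                                                             (length-revLayered-∣ k u (m≤n⇒m≤1+n (n<1+n u))) ⟩
    2 ^ k + 2 ^ k                              ≡⟨ cong (2 ^ k +_) (sym (+-identityʳ _)) ⟩
    2 ^ suc k                                  ∎
    where open ≡-Reasoning
  length-revLayered-∣ k (suc r) 1+r<t =
    trans (length-revLayered-¬cut (∤-within-row k (s≤s z≤n) 1+r<t))
          (length-revLayered-∣ k r (<-trans (n<1+n r) 1+r<t))

corollary3p8 : (∀ (s : ℕ) → 1 ≤ s → HasCard (NE-213-132 s 1) 1)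
    × (∀ (s t : ℕ) → 1 ≤ s → 2 ≤ t → HasCard (NE-213-132 s t) (2 ^ (s ∸ 1)))
corollary3p8 = chain , grid
  where
  chain : ∀ s → 1 ≤ s → HasCard (NE-213-132 s 1) 1
  chain s _ =
    subst (HasCard (NE-213-132 s 1)) (length-revLayered-no-cuts (s * 1))
      (NoCuts.HasCard-LinExt-213-132 (λ ()) (NE≼ s 1) (s * 1) NE≼-bounds
        (λ 1≤x x<s*1 _ → NE≼-chain-step 1≤x (subst (_ <_) (*-identityʳ s) x<s*1))
        (λ ()))

  grid : ∀ s t → 1 ≤ s → 2 ≤ t → HasCard (NE-213-132 s t) (2 ^ (s ∸ 1))
  grid (suc s) t@(suc (suc u)) _ 1<t =
    subst (HasCard (NE-213-132 (suc s) t)) (length-revLayered-∣ u s (suc u) ≤-refl)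
      (DivisibilityCuts.HasCard-LinExt-213-132 t (∣⇒∤suc 1<t) (NE≼ (suc s) t) (suc s * t) NE≼-bounds
        (λ _ x<st t∤x → NE≼-row-step t∤x x<st)
        (NE≼-∣⇒¬step 1<t))
  grid (suc s) (suc zero) _ (s≤s ())
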